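{- The update operator $\oplus_3$ satisfies, for all extended logic programs $P,P_1,P_2$ and every rule $x$: (BK-1) $P\oplus_3\{x\}$ is a program; (BK-2) $P_1\oplus_3P_2\vdash_{N_2}P_2$; (BK-3) $P_1\cup P_2\vdash_{N_2}P_1\oplus_3P_2$; (BK-5) if $P_2\equiv_{N_2}\bot$ then $P_1\oplus_3P_2\equiv_{N_2}\bot$. Moreover it satisfies (BK-6) when $P_1$ and $P_2$ are tau-free: for any extended logic program $P$ and tau-free extended logic programs $P_1,P_2$, if $P_1\equiv_{N_2}P_2$ then $P\oplus_3P_1$ and $P\oplus_3P_2$ have the same answer sets.
   Context: Formulas use $\wedge,\vee,\rightarrow,\bot$ and strong negation $\sim$; $\lnot F$ is $F\rightarrow\bot$, $\top$ is $\bot\rightarrow\bot$. A literal is an atom $a$ or $\sim a$; $\sim L$ is the complement of $L$. An extended logic program (ELP) is a finite set of rules $r$: $L\leftarrow B_1,\dots,B_m,\lnot B_{m+1},\dots,\lnot B_n$ ($L,B_i$ literals, $\top$ or $\bot$); $H(r)=L$, $B(r)$ the body ($\top$ if empty); constraint if $H(r)=\bot$. A program is a finite set of formulas $G\rightarrow l$, $l$ a literal, $G$ built from literals, $\top,\bot$ by $\wedge,\vee,\lnot$. An ELP is tau-free if it contains no rule of the form $l\leftarrow l,\alpha$ (with $l$ a literal and $\alpha$ a possibly empty body). $\mathrm{N}_2$ is intuitionistic logic plus Nelson's axioms ($\sim(\alpha\rightarrow\beta)\leftrightarrow\alpha\wedge\sim\beta$, $\sim(\alpha\wedge\beta)\leftrightarrow\sim\alpha\vee\sim\beta$,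 $\sim(\alpha\vee\beta)\leftrightarrow\sim\alpha\wedge\sim\beta$, $\alpha\leftrightarrow\sim\sim\alpha$, $\sim\lnot\alpha\leftrightarrow\alpha$, $\sim a\rightarrow\lnot a$) and $\alpha\vee(\alpha\rightarrow\beta)\vee\lnot\beta$. $T\vdash_{N_2}T'$: $T$ derives every formula of $T'$; $\equiv_{N_2}$: mutual derivability; $\equiv_{N_2}\bot$: $\mathrm{N}_2$-inconsistent. For a finite set of formulas $T$ over atoms $\mathcal{A}$, a consistent $M\subseteq Lit_{\mathcal{A}}$ is an answer set iff $T\cup\{\lnot l: l\in Lit_{\mathcal{A}}\setminus M\}\cup\{\lnot\lnot l:l\in M\}$ is $\mathrm{N}_2$-consistent and $\mathrm{N}_2$-derives each element of $M$. Operator $\oplus_3$: for a program $P$ and literal $L$ let $K_L=\{B(r): r\in P, H(r)=L\}$ and $sup(L,P)=\bot$ if no rule of $P$ has head $L$, $\top$ if some rule of $P$ with head $L$ has body $\top$, and $\bigvee K_L$ otherwise. $P_1\oplus_3P_2$ consists of (i) all constraints of $P_1\cup P_2$; (ii) for each non-constraint $r\in P_1$ with $H(r)=L$: $L\leftarrow B(r),\lnot sup(\sim L,P_2)$; (iii) all rules of $P_2$. -}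

module Defs where

open import Data.Nat using (ℕ)
open import Data.Fin using (Fin)
open import Data.Fin.Properties using () renaming (_≟_ to _≟F_)
open import Data.Bool using (Bool; true; false; if_then_else_)
open import Data.List using (List; []; _∷_; _++_; map; concatMap; allFin)
open import Data.List.Relation.Unary.All using (All)
open import Data.List.Membership.Propositional using (_∈_)
open import Data.Maybe using (Maybe; just; nothing)
open import Data.Product using (Σ; _×_; _,_)
open import Data.Sum using (_⊎_)
open import Data.Empty using (⊥)
open import Relation.Nullary using (¬_; yes; no; Dec)
open import Relation.Binary.PropositionalEquality using (_≡_; refl; cong)


variable
  n : ℕ

infixr 6 _∧_
infixr 5 _∨_
infixr 4 _⇒_

data Fm (n : ℕ) : Set where
  atom : Fin n → Fm n
  ⊥'   : Fm n
  _∧_  : Fm n → Fm n → Fm n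
  _∨_  : Fm n → Fm n → Fm n
  _⇒_  : Fm n → Fm n → Fm n
  ∼_   : Fm n → Fm n

¬' : Fm n → Fm n
¬' F = F ⇒ ⊥'

⊤' : Fm n
⊤' = ⊥' ⇒ ⊥'

_⇔'_ : Fm n → Fm n → Fm n
α ⇔' β = (α ⇒ β) ∧ (β ⇒ α)

-- The logic N₂ as a Hilbert system with modus ponens;
-- Γ ⊢ φ : φ is derivable in N₂ from the (finite) set of premises Γ.

infix 3 _⊢_

data _⊢_ {n : ℕ} (Γ : List (Fm n)) : Fm n → Set where
  hyp  : ∀ {φ} → φ ∈ Γ → Γ ⊢ φ
  mp   : ∀ {φ ψ} → Γ ⊢ φ ⇒ ψ → Γ ⊢ φ → Γ ⊢ ψ
  ax-K   : ∀ {α β} → Γ ⊢ α ⇒ β ⇒ α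
  ax-S   : ∀ {α β γ} → Γ ⊢ (α ⇒ β ⇒ γ) ⇒ (α ⇒ β) ⇒ α ⇒ γ
  ax-∧E₁ : ∀ {α β} → Γ ⊢ α ∧ β ⇒ α
  ax-∧E₂ : ∀ {α β} → Γ ⊢ α ∧ β ⇒ β
  ax-∧I  : ∀ {α β} → Γ ⊢ α ⇒ β ⇒ α ∧ β
  ax-∨I₁ : ∀ {α β} → Γ ⊢ α ⇒ α ∨ β
  ax-∨I₂ : ∀ {α β} → Γ ⊢ β ⇒ α ∨ β
  ax-∨E  : ∀ {α β γ} → Γ ⊢ (α ⇒ γ) ⇒ (β ⇒ γ) ⇒ α ∨ β ⇒ γ
  ax-⊥E  : ∀ {α} → Γ ⊢ ⊥' ⇒ α
  -- Nelson's axioms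
  ax-N1 : ∀ {α β} → Γ ⊢ (∼ (α ⇒ β)) ⇔' (α ∧ ∼ β)
  ax-N2 : ∀ {α β} → Γ ⊢ (∼ (α ∧ β)) ⇔' (∼ α ∨ ∼ β)
  ax-N3 : ∀ {α β} → Γ ⊢ (∼ (α ∨ β)) ⇔' (∼ α ∧ ∼ β)
  ax-N4 : ∀ {α} → Γ ⊢ α ⇔' (∼ (∼ α))
  ax-N5 : ∀ {α} → Γ ⊢ (∼ (¬' α)) ⇔' α
  ax-N6 : ∀ {a} → Γ ⊢ (∼ atom a) ⇒ ¬' (atom a)
  ax-N₂ : ∀ {α β} → Γ ⊢ α ∨ (α ⇒ β) ∨ ¬' β

_⊢*_ : List (Fm n) → List (Fm n) → Set
T ⊢* T' = All (T ⊢_) T'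

_≡N₂_ : List (Fm n) → List (Fm n) → Set
T ≡N₂ T' = (T ⊢* T') × (T' ⊢* T)

InconsistentN₂ : List (Fm n) → Set
InconsistentN₂ T = T ≡N₂ (⊥' ∷ [])

ConsistentN₂ : List (Fm n) → Set
ConsistentN₂ T = ¬ (T ⊢ ⊥')

data Lit (n : ℕ) : Set where
  pos : Fin n → Lit n
  neg : Fin n → Lit n

compl : Lit n → Lit n
compl (pos a) = neg a
compl (neg a) = pos a

litFm : Lit n → Fm n
litFm (pos a) = atom a
litFm (neg a) = ∼ atom a

_≟L_ : (l l' : Lit n) → Dec (l ≡ l')
pos a ≟L pos b with a ≟F b
... | yes refl = yes refl
... | no ne = no λ { refl → ne refl }
pos a ≟L neg b = no λ ()
neg a ≟L pos b = no λ ()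
neg a ≟L neg b with a ≟F b
... | yes refl = yes refl
... | no ne = no λ { refl → ne refl }

allLits : (n : ℕ) → List (Lit n)
allLits n = concatMap (λ a → pos a ∷ neg a ∷ []) (allFin n)

data BElem (n : ℕ) : Set where
  lit : Lit n → BElem n
  top : BElem n
  bot : BElem n

belemFm : BElem n → Fm n
belemFm (lit l) = litFm l
belemFm top = ⊤'
belemFm bot = ⊥'

-- L ← B₁,…,B_m, ¬B_{m+1},…,¬B_n ; head nothing = ⊥ (constraint)
record Rule (n : ℕ) : Set where
  constructor _←_,not_
  field
    head  : Maybe (Lit n)
    posB  : List (BElem n)
    negB  : List (BElem n)
open Rule public

ELP : ℕ → Set
ELP n = List (Rule n)

⋀ : List (Fm n) → Fm n
⋀ [] = ⊤'
⋀ (φ ∷ []) = φ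
⋀ (φ ∷ ψ ∷ φs) = φ ∧ ⋀ (ψ ∷ φs)

⋁ : List (Fm n) → Fm n
⋁ [] = ⊥'
⋁ (φ ∷ []) = φ
⋁ (φ ∷ ψ ∷ φs) = φ ∨ ⋁ (ψ ∷ φs)

bodyFm : Rule n → Fm n
bodyFm r = ⋀ (map belemFm (posB r) ++ map (λ b → ¬' (belemFm b)) (negB r))

headFm : Maybe (Lit n) → Fm n
headFm (just l) = litFm l
headFm nothing = ⊥'

ruleFm : Rule n → Fm n
ruleFm r = bodyFm r ⇒ headFm (head r)

⟦_⟧ : List (Rule n) → List (Fm n)
⟦ P ⟧ = map ruleFm P

emptyBody : Rule n → Bool
emptyBody record { posB = [] ; negB = [] } = true
emptyBody _ = false

hasHead : Lit n → Rule n → Bool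
hasHead L r with head r
... | nothing = false
... | just L' with L ≟L L'
...   | yes _ = true
...   | no _ = false

K : Lit n → ELP n → List (Fm n)
K L [] = []
K L (r ∷ P) = if hasHead L r then bodyFm r ∷ K L P else K L P

anyFact : Lit n → ELP n → Bool
anyFact L [] = false
anyFact L (r ∷ P) = if hasHead L r then (if emptyBody r then true else anyFact L P) else anyFact L P

sup : Lit n → ELP n → Fm n
sup L P with K L P
... | [] = ⊥'
... | _ ∷ _ = if anyFact L P then ⊤' else ⋁ (K L P)

constraints : ELP n → ELP n
constraints [] = []
constraints (r ∷ P) with head r
... | nothing = r ∷ constraints P
... | just _ = constraints P

weakened : ELP n → ELP n → List (Fm n)
weakened [] P₂ = []
weakened (r ∷ P₁) P₂ with head r
... | nothing = weakened P₁ P₂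
... | just L = ((bodyFm r ∧ ¬' (sup (compl L) P₂)) ⇒ litFm L) ∷ weakened P₁ P₂

_⊕₃_ : ELP n → ELP n → List (Fm n)
P₁ ⊕₃ P₂ = ⟦ constraints (P₁ ++ P₂) ⟧ ++ weakened P₁ P₂ ++ ⟦ P₂ ⟧

data IsG {n : ℕ} : Fm n → Set where
  g-lit : ∀ l → IsG (litFm l)
  g-⊤   : IsG ⊤'
  g-⊥   : IsG ⊥'
  g-∧   : ∀ {G H} → IsG G → IsG H → IsG (G ∧ H)
  g-∨   : ∀ {G H} → IsG G → IsG H → IsG (G ∨ H)
  g-¬   : ∀ {G} → IsG G → IsG (¬' G)

data IsProgramFm {n : ℕ} : Fm n → Set where
  prog-lit : ∀ {G} l → IsG G → IsProgramFm (G ⇒ litFm l)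
  prog-⊥   : ∀ {G} → IsG G → IsProgramFm (G ⇒ ⊥')

IsProgram : List (Fm n) → Set
IsProgram T = All IsProgramFm T

TauFree : ELP n → Set
TauFree P = ∀ {r} → r ∈ P → ∀ l → head r ≡ just l → ¬ (lit l ∈ posB r)

-- Answer sets; M ⊆ Lit_𝒜 given by its characteristic function

_∈M_ : Lit n → (Lit n → Bool) → Set
l ∈M M = M l ≡ true

ConsistentLits : (Lit n → Bool) → Set
ConsistentLits M = ∀ a → ¬ ((pos a ∈M M) × (neg a ∈M M))

reductAssumptions : (n : ℕ) → (Lit n → Bool) → List (Fm n)
reductAssumptions n M =
  map (λ l → if M l then ¬' (¬' (litFm l)) else ¬' (litFm l)) (allLits n)

AnswerSet : List (Fm n) → (Lit n → Bool) → Set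
AnswerSet {n} T M =
  ConsistentLits M ×
  ConsistentN₂ (T ++ reductAssumptions n M) ×
  (∀ l → l ∈M M → (T ++ reductAssumptions n M) ⊢ litFm l)

{-# OPTIONS --safe #-}
-- BK-1 to BK-5 only concern which rules occur in P₁ ⊕₃ P₂: P₂ occurs verbatim, and each
-- weakened rule follows from the rule of P₁ it weakens.
--
-- For BK-6 fix a consistent set M of literals and let R = {¬l : l ∉ M} ∪ {¬¬l : l ∈ M}.
-- R decides every rule body G, deriving ¬¬G or ¬G according as G holds in M; so when
-- (P ⊕₃ P₁) ∪ R is consistent, M is a classical model of P₁ and hence of P₂. Beyond
-- P₁ ≡ P₂, the two updates differ only in the guards ¬ sup(∼L, Pᵢ), and R decides these
-- alike: if some rule of P₁ for ℓ fires in M but no rule of P₂ does, the here-and-there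
-- interpretation ⟨M ∖ {ℓ}, M⟩ satisfies P₂, while tau-freeness keeps the body of the
-- firing rule true at M ∖ {ℓ}, so that rule fails there, contradicting P₂ ⊢ P₁ by
-- soundness of N₂ for here-and-there models. Thus (P ⊕₃ P₁) ∪ R and (P ⊕₃ P₂) ∪ R are
-- inter-derivable, and M is an answer set of both or of neither.
module Submission where

open import Defs
open import Data.Nat using (ℕ)
open import Data.Bool using (Bool; true; false; if_then_else_)
open import Data.Bool.Properties using (¬-not) renaming (_≟_ to _≟ᴮ_)
open import Data.Empty using (⊥; ⊥-elim)
open import Data.Unit using (tt) renaming (⊤ to Unit)
open import Data.List using (List; []; _∷_; _++_; map)
open import Data.List.Relation.Unary.All as All using (All; []; _∷_)
open import Data.List.Relation.Unary.All.Properties using (++⁺; ++⁻; map⁺; map⁻)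
open import Data.List.Relation.Unary.Any as Any using (Any; here; there)
open import Data.List.Relation.Unary.Any.Properties using (¬Any[])
open import Data.List.Membership.Propositional using (_∈_; find; lose)
open import Data.List.Membership.Propositional.Properties using (∈-map⁺; ∈-allFin; ∈-concatMap⁺)
open import Data.List.Relation.Binary.Subset.Propositional using (_⊆_)
open import Data.List.Relation.Binary.Subset.Propositional.Properties
  using (xs⊆xs++ys; xs⊆ys++xs; ∷⁺ʳ) renaming (map⁺ to ⊆-map⁺)
open import Data.Maybe using (just; nothing)
open import Data.Product using (_×_; _,_; proj₁; proj₂; swap)
open import Data.Sum using (_⊎_; inj₁; inj₂; [_,_]) renaming (map to ⊎-map)
open import Function using (_∘_; id; const)
open import Function.Bundles using (_⇔_; mk⇔)
open import Relation.Nullary using (¬_; yes; no; Dec)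
open import Relation.Nullary.Decidable using (_×-dec_; _⊎-dec_; _→-dec_)
open import Relation.Binary.PropositionalEquality using (_≡_; _≢_; refl; sym; cong; subst)

private variable
  Γ Δ Θ : List (Fm n)
  φ ψ χ θ : Fm n
  P₁ P₂ : ELP n

⊢-rec : (F : Fm n → Set) → (∀ {ψ} → ψ ∈ Δ → F ψ) → (∀ {ψ χ} → F (ψ ⇒ χ) → F ψ → F χ) →
        (∀ {ψ} → (∀ {Γ} → Γ ⊢ ψ) → F ψ) → Δ ⊢ φ → F φ
⊢-rec {Δ = Δ} F assumption modusPonens axiom = go
  where
  go : ∀ {φ} → Δ ⊢ φ → F φ
  go (hyp φ∈Δ) = assumption φ∈Δ
  go (mp d e) = modusPonens (go d) (go e)
  go ax-K = axiom ax-K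
  go ax-S = axiom ax-S
  go ax-∧E₁ = axiom ax-∧E₁
  go ax-∧E₂ = axiom ax-∧E₂
  go ax-∧I = axiom ax-∧I
  go ax-∨I₁ = axiom ax-∨I₁
  go ax-∨I₂ = axiom ax-∨I₂
  go ax-∨E = axiom ax-∨E
  go ax-⊥E = axiom ax-⊥E
  go ax-N1 = axiom ax-N1
  go ax-N2 = axiom ax-N2
  go ax-N3 = axiom ax-N3
  go ax-N4 = axiom ax-N4
  go ax-N5 = axiom ax-N5
  go ax-N6 = axiom ax-N6
  go ax-N₂ = axiom ax-N₂

⊢-cut : Γ ⊢* Δ → Δ ⊢ φ → Γ ⊢ φ
⊢-cut {Γ = Γ} Γ⊢Δ = ⊢-rec (Γ ⊢_) (All.lookup Γ⊢Δ) mp (λ axiom → axiom)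

⊢*-trans : Γ ⊢* Δ → Δ ⊢* Θ → Γ ⊢* Θ
⊢*-trans Γ⊢Δ = All.map (⊢-cut Γ⊢Δ)

⊆⇒⊢* : Δ ⊆ Γ → Γ ⊢* Δ
⊆⇒⊢* Δ⊆Γ = All.tabulate (hyp ∘ Δ⊆Γ)

⊢-weaken : Δ ⊆ Γ → Δ ⊢ φ → Γ ⊢ φ
⊢-weaken = ⊢-cut ∘ ⊆⇒⊢*

⊢-id : Γ ⊢ φ ⇒ φ
⊢-id {φ = φ} = mp (mp ax-S ax-K) (ax-K {β = φ})

⊢-deduction : (φ ∷ Γ) ⊢ ψ → Γ ⊢ φ ⇒ ψ
⊢-deduction {φ = φ} {Γ = Γ} =
  ⊢-rec (λ ψ → Γ ⊢ φ ⇒ ψ) assumption (mp ∘ mp ax-S) (λ axiom → mp ax-K axiom)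
  where
  assumption : ∀ {ψ} → ψ ∈ φ ∷ Γ → Γ ⊢ φ ⇒ ψ
  assumption (here refl) = ⊢-id
  assumption (there ψ∈Γ) = mp ax-K (hyp ψ∈Γ)

private
  assumed : (φ ∷ Γ) ⊢ φ
  assumed = hyp (here refl)

  ↑ : Γ ⊢ φ → (ψ ∷ Γ) ⊢ φ
  ↑ = ⊢-weaken there

∧-intro : Γ ⊢ φ → Γ ⊢ ψ → Γ ⊢ φ ∧ ψ
∧-intro d e = mp (mp ax-∧I d) e

contraposition : Γ ⊢ φ ⇒ ψ → Γ ⊢ ¬' ψ ⇒ ¬' φ
contraposition f = ⊢-deduction (⊢-deduction (mp (↑ assumed) (mp (↑ (↑ f)) assumed)))

¬¬-intro : Γ ⊢ φ → Γ ⊢ ¬' (¬' φ)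
¬¬-intro d = ⊢-deduction (mp assumed (↑ d))

¬¬-map : Γ ⊢ φ ⇒ ψ → Γ ⊢ ¬' (¬' φ) → Γ ⊢ ¬' (¬' ψ)
¬¬-map = mp ∘ contraposition ∘ contraposition

¬¬-∧ : Γ ⊢ ¬' (¬' φ) → Γ ⊢ ¬' (¬' ψ) → Γ ⊢ ¬' (¬' (φ ∧ ψ))
¬¬-∧ d e = ⊢-deduction (mp (↑ d) (⊢-deduction
             (mp (↑ (↑ e)) (⊢-deduction (mp (↑ (↑ assumed)) (∧-intro (↑ assumed) assumed))))))

¬¬⊥-elim : Γ ⊢ ¬' (¬' ⊥') → Γ ⊢ ⊥'
¬¬⊥-elim d = mp d ⊢-id

¬-∧ˡ : Γ ⊢ ¬' φ → Γ ⊢ ¬' (φ ∧ ψ)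
¬-∧ˡ = mp (contraposition ax-∧E₁)

¬-∧ʳ : Γ ⊢ ¬' ψ → Γ ⊢ ¬' (φ ∧ ψ)
¬-∧ʳ = mp (contraposition ax-∧E₂)

¬-∨ : Γ ⊢ ¬' φ → Γ ⊢ ¬' ψ → Γ ⊢ ¬' (φ ∨ ψ)
¬-∨ d e = mp (mp ax-∨E d) e

∧-antecedent-weaken : Γ ⊢ φ ⇒ χ → Γ ⊢ φ ∧ ψ ⇒ χ
∧-antecedent-weaken r = ⊢-deduction (mp (↑ r) (mp ax-∧E₁ assumed))

∧-antecedent-discharge : Γ ⊢ ψ → Γ ⊢ φ ∧ ψ ⇒ χ → Γ ⊢ φ ∧ θ ⇒ χ
∧-antecedent-discharge d r = ⊢-deduction (mp (↑ r) (∧-intro (mp ax-∧E₁ assumed) (↑ d)))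

∧-antecedent-absurd : Γ ⊢ ¬' (¬' ψ) → Γ ⊢ φ ∧ ¬' ψ ⇒ χ
∧-antecedent-absurd d = ⊢-deduction (mp ax-⊥E (mp (↑ d) (mp ax-∧E₂ assumed)))

∈-allLits : ∀ (l : Lit n) → l ∈ allLits n
∈-allLits (pos a) =
  ∈-concatMap⁺ (λ a → pos a ∷ neg a ∷ []) (Any.map (λ { refl → here refl }) (∈-allFin a))
∈-allLits (neg a) =
  ∈-concatMap⁺ (λ a → pos a ∷ neg a ∷ []) (Any.map (λ { refl → there (here refl) }) (∈-allFin a))

hasHead⇒head≡ : ∀ {L} (r : Rule n) → hasHead L r ≡ true → head r ≡ just L
hasHead⇒head≡ {L = L} record { head = just L' } eq with L ≟L L'
... | yes refl = refl
hasHead⇒head≡ record { head = just _ } () | no _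
hasHead⇒head≡ record { head = nothing } ()

head≡⇒hasHead : ∀ {L} (r : Rule n) → head r ≡ just L → hasHead L r ≡ true
head≡⇒hasHead {L = L} record { head = just .L } refl with L ≟L L
... | yes _ = refl
... | no L≢L = ⊥-elim (L≢L refl)

Any-K⁻ : ∀ {L} {Q : Fm n → Set} (P : ELP n) →
         Any Q (K L P) → Any (λ r → head r ≡ just L × Q (bodyFm r)) P
Any-K⁻ {L = L} (r ∷ P) q with hasHead L r in hd
Any-K⁻ (r ∷ P) (here q) | true = here (hasHead⇒head≡ r hd , q)
Any-K⁻ (r ∷ P) (there q) | true = there (Any-K⁻ P q)
Any-K⁻ (r ∷ P) q | false = there (Any-K⁻ P q)

Any-K⁺ : ∀ {L} {Q : Fm n → Set} (P : ELP n) →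
         Any (λ r → head r ≡ just L × Q (bodyFm r)) P → Any Q (K L P)
Any-K⁺ (r ∷ P) (here (hd , q)) rewrite head≡⇒hasHead r hd = here q
Any-K⁺ {L = L} (r ∷ P) (there s) with hasHead L r
... | true = there (Any-K⁺ P s)
... | false = Any-K⁺ P s

emptyBody⇒bodyFm≡⊤ : ∀ (r : Rule n) → emptyBody r ≡ true → bodyFm r ≡ ⊤'
emptyBody⇒bodyFm≡⊤ record { posB = [] ; negB = [] } _ = refl
emptyBody⇒bodyFm≡⊤ record { posB = [] ; negB = _ ∷ _ } ()
emptyBody⇒bodyFm≡⊤ record { posB = _ ∷ _ } ()

anyFact⇒fact : ∀ {L} (P : ELP n) → anyFact L P ≡ true →
               Any (λ r → head r ≡ just L × bodyFm r ≡ ⊤') P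
anyFact⇒fact {L = L} (r ∷ P) eq with hasHead L r in hd
... | false = there (anyFact⇒fact P eq)
... | true with emptyBody r in empty
...   | true = here (hasHead⇒head≡ r hd , emptyBody⇒bodyFm≡⊤ r empty)
...   | false = there (anyFact⇒fact P eq)

constraints-⊆ : ∀ (P : ELP n) → constraints P ⊆ P
constraints-⊆ [] = λ ()
constraints-⊆ (r ∷ P) with head r
... | nothing = ∷⁺ʳ r (constraints-⊆ P)
... | just _ = λ r∈ → there (constraints-⊆ P r∈)

⟦constraints-++⟧-⊆ : ∀ (P : ELP n) {Q Q′} →
                     ⟦ constraints (P ++ Q) ⟧ ⊆ ⟦ constraints (P ++ Q′) ⟧ ++ ⟦ Q ⟧
⟦constraints-++⟧-⊆ [] {Q} {Q′} =
  xs⊆ys++xs ⟦ Q ⟧ ⟦ constraints Q′ ⟧ ∘ ⊆-map⁺ ruleFm (constraints-⊆ Q)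
⟦constraints-++⟧-⊆ (r ∷ P) with head r
... | nothing = ∷⁺ʳ (ruleFm r) (⟦constraints-++⟧-⊆ P)
... | just _ = ⟦constraints-++⟧-⊆ P

constraints⊆⊕₃ : ⟦ constraints (P₁ ++ P₂) ⟧ ⊆ P₁ ⊕₃ P₂
constraints⊆⊕₃ {P₁ = P₁} {P₂} = xs⊆xs++ys ⟦ constraints (P₁ ++ P₂) ⟧ _

weakened⊆⊕₃ : weakened P₁ P₂ ⊆ P₁ ⊕₃ P₂
weakened⊆⊕₃ {P₁ = P₁} {P₂} =
  xs⊆ys++xs _ ⟦ constraints (P₁ ++ P₂) ⟧ ∘ xs⊆xs++ys (weakened P₁ P₂) ⟦ P₂ ⟧

⟦⟧⊆⊕₃ : ⟦ P₂ ⟧ ⊆ P₁ ⊕₃ P₂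
⟦⟧⊆⊕₃ {P₂ = P₂} {P₁} =
  xs⊆ys++xs _ ⟦ constraints (P₁ ++ P₂) ⟧ ∘ xs⊆ys++xs ⟦ P₂ ⟧ (weakened P₁ P₂)

IsG-belemFm : ∀ (b : BElem n) → IsG (belemFm b)
IsG-belemFm (lit l) = g-lit l
IsG-belemFm top = g-⊤
IsG-belemFm bot = g-⊥

IsG-⋀ : ∀ {φs : List (Fm n)} → All IsG φs → IsG (⋀ φs)
IsG-⋀ [] = g-⊤
IsG-⋀ (g ∷ []) = g
IsG-⋀ (g ∷ gs@(_ ∷ _)) = g-∧ g (IsG-⋀ gs)

IsG-⋁ : ∀ {φs : List (Fm n)} → All IsG φs → IsG (⋁ φs)
IsG-⋁ [] = g-⊥
IsG-⋁ (g ∷ []) = g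
IsG-⋁ (g ∷ gs@(_ ∷ _)) = g-∨ g (IsG-⋁ gs)

IsG-bodyFm : ∀ (r : Rule n) → IsG (bodyFm r)
IsG-bodyFm r = IsG-⋀ (++⁺ (map⁺ (All.universal IsG-belemFm (posB r)))
                          (map⁺ (All.universal (g-¬ ∘ IsG-belemFm) (negB r))))

IsG-K : ∀ L (P : ELP n) → All IsG (K L P)
IsG-K L [] = []
IsG-K L (r ∷ P) with hasHead L r
... | true = IsG-bodyFm r ∷ IsG-K L P
... | false = IsG-K L P

IsG-sup : ∀ L (P : ELP n) → IsG (sup L P)
IsG-sup L P with K L P
... | [] = g-⊥
... | _ ∷ _ with anyFact L P
...   | true = g-⊤
...   | false = IsG-⋁ (IsG-K L P)

IsProgramFm-ruleFm : ∀ (r : Rule n) → IsProgramFm (ruleFm r)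
IsProgramFm-ruleFm r@record { head = just l } = prog-lit l (IsG-bodyFm r)
IsProgramFm-ruleFm r@record { head = nothing } = prog-⊥ (IsG-bodyFm r)

IsProgram-⟦⟧ : ∀ (P : ELP n) → IsProgram ⟦ P ⟧
IsProgram-⟦⟧ P = map⁺ (All.universal IsProgramFm-ruleFm P)

IsProgram-weakened : ∀ (P Q : ELP n) → IsProgram (weakened P Q)
IsProgram-weakened [] Q = []
IsProgram-weakened (r@record { head = just l } ∷ P) Q =
  prog-lit l (g-∧ (IsG-bodyFm r) (g-¬ (IsG-sup (compl l) Q))) ∷ IsProgram-weakened P Q
IsProgram-weakened (record { head = nothing } ∷ P) Q = IsProgram-weakened P Q

IsProgram-⊕₃ : ∀ (P₁ P₂ : ELP n) → IsProgram (P₁ ⊕₃ P₂)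
IsProgram-⊕₃ P₁ P₂ =
  ++⁺ (IsProgram-⟦⟧ (constraints (P₁ ++ P₂))) (++⁺ (IsProgram-weakened P₁ P₂) (IsProgram-⟦⟧ P₂))

⊕₃-⊢*-⟦⟧ : ∀ (P₁ P₂ : ELP n) → (P₁ ⊕₃ P₂) ⊢* ⟦ P₂ ⟧
⊕₃-⊢*-⟦⟧ P₁ P₂ = ⊆⇒⊢* (⟦⟧⊆⊕₃ {P₂ = P₂} {P₁})

⊢*-weakened : ∀ P {Q : ELP n} → ⟦ P ⟧ ⊆ Γ → Γ ⊢* weakened P Q
⊢*-weakened [] _ = []
⊢*-weakened (record { head = nothing } ∷ P) P⊆Γ = ⊢*-weakened P (P⊆Γ ∘ there)
⊢*-weakened (record { head = just _ } ∷ P) P⊆Γ =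
  ∧-antecedent-weaken (hyp (P⊆Γ (here refl))) ∷ ⊢*-weakened P (P⊆Γ ∘ there)

++-⊢*-⊕₃ : ∀ (P₁ P₂ : ELP n) → ⟦ P₁ ++ P₂ ⟧ ⊢* (P₁ ⊕₃ P₂)
++-⊢*-⊕₃ P₁ P₂ =
  ++⁺ (⊆⇒⊢* (⊆-map⁺ ruleFm (constraints-⊆ (P₁ ++ P₂))))
      (++⁺ (⊢*-weakened P₁ (⊆-map⁺ ruleFm (xs⊆xs++ys P₁ P₂)))
           (⊆⇒⊢* (⊆-map⁺ ruleFm (xs⊆ys++xs P₂ P₁))))

⊕₃-inconsistent : ∀ (P₁ P₂ : ELP n) → InconsistentN₂ ⟦ P₂ ⟧ → InconsistentN₂ (P₁ ⊕₃ P₂)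
⊕₃-inconsistent P₁ P₂ (P₂⊢⊥ ∷ [] , _) =
  ⊢-cut (⊕₃-⊢*-⟦⟧ P₁ P₂) P₂⊢⊥ ∷ [] , All.universal (λ _ → mp ax-⊥E (hyp (here refl))) _

module Classical {n : ℕ} (M : Lit n → Bool) where

  -- Strong negation makes truth ⊨⁺ and falsity ⊨⁻ independent; ⊨⁻ ⊥' holds because
  -- axiom N5 (∼¬α ↔ α) demands it.
  infix 4 ⊨⁺_ ⊨⁻_

  ⊨⁺_ ⊨⁻_ : Fm n → Set
  ⊨⁺ atom a = pos a ∈M M
  ⊨⁺ ⊥' = ⊥
  ⊨⁺ (α ∧ β) = ⊨⁺ α × ⊨⁺ β
  ⊨⁺ (α ∨ β) = ⊨⁺ α ⊎ ⊨⁺ β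
  ⊨⁺ (α ⇒ β) = ⊨⁺ α → ⊨⁺ β
  ⊨⁺ (∼ α) = ⊨⁻ α
  ⊨⁻ atom a = neg a ∈M M
  ⊨⁻ ⊥' = Unit
  ⊨⁻ (α ∧ β) = ⊨⁻ α ⊎ ⊨⁻ β
  ⊨⁻ (α ∨ β) = ⊨⁻ α × ⊨⁻ β
  ⊨⁻ (α ⇒ β) = ⊨⁺ α × ⊨⁻ β
  ⊨⁻ (∼ α) = ⊨⁺ α

  ⊨⁺? : ∀ φ → Dec (⊨⁺ φ)
  ⊨⁻? : ∀ φ → Dec (⊨⁻ φ)
  ⊨⁺? (atom a) = M (pos a) ≟ᴮ true
  ⊨⁺? ⊥' = no λ ()
  ⊨⁺? (α ∧ β) = ⊨⁺? α ×-dec ⊨⁺? β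
  ⊨⁺? (α ∨ β) = ⊨⁺? α ⊎-dec ⊨⁺? β
  ⊨⁺? (α ⇒ β) = ⊨⁺? α →-dec ⊨⁺? β
  ⊨⁺? (∼ α) = ⊨⁻? α
  ⊨⁻? (atom a) = M (neg a) ≟ᴮ true
  ⊨⁻? ⊥' = yes tt
  ⊨⁻? (α ∧ β) = ⊨⁻? α ⊎-dec ⊨⁻? β
  ⊨⁻? (α ∨ β) = ⊨⁻? α ×-dec ⊨⁻? β
  ⊨⁻? (α ⇒ β) = ⊨⁺? α ×-dec ⊨⁻? β
  ⊨⁻? (∼ α) = ⊨⁺? α

  ∈M⇒⊨⁺ : ∀ l → l ∈M M → ⊨⁺ litFm l
  ∈M⇒⊨⁺ (pos a) = id
  ∈M⇒⊨⁺ (neg a) = id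

  ⊨⁺⇒∈M : ∀ l → ⊨⁺ litFm l → l ∈M M
  ⊨⁺⇒∈M (pos a) = id
  ⊨⁺⇒∈M (neg a) = id

  ⊨⁺-⋀⁻ : ∀ φs → ⊨⁺ ⋀ φs → All ⊨⁺_ φs
  ⊨⁺-⋀⁻ [] _ = []
  ⊨⁺-⋀⁻ (φ ∷ []) v = v ∷ []
  ⊨⁺-⋀⁻ (φ ∷ ψ ∷ φs) (v , vs) = v ∷ ⊨⁺-⋀⁻ (ψ ∷ φs) vs

  ⊨⁺-⋁⁻ : ∀ φs → ⊨⁺ ⋁ φs → Any ⊨⁺_ φs
  ⊨⁺-⋁⁻ (φ ∷ []) v = here v
  ⊨⁺-⋁⁻ (φ ∷ ψ ∷ φs) (inj₁ v) = here v
  ⊨⁺-⋁⁻ (φ ∷ ψ ∷ φs) (inj₂ v) = there (⊨⁺-⋁⁻ (ψ ∷ φs) v)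

  ⊨⁺-⋁⁺ : ∀ {φs} → Any ⊨⁺_ φs → ⊨⁺ ⋁ φs
  ⊨⁺-⋁⁺ {φ ∷ []} (here v) = v
  ⊨⁺-⋁⁺ {φ ∷ ψ ∷ φs} (here v) = inj₁ v
  ⊨⁺-⋁⁺ {φ ∷ ψ ∷ φs} (there v) = inj₂ (⊨⁺-⋁⁺ v)

  ⊨⁺-bodyFm⁻ : ∀ r → ⊨⁺ bodyFm r →
               All (⊨⁺_ ∘ belemFm) (posB r) × All (¬_ ∘ ⊨⁺_ ∘ belemFm) (negB r)
  ⊨⁺-bodyFm⁻ r v with ++⁻ (map belemFm (posB r)) (⊨⁺-⋀⁻ _ v)
  ... | vs⁺ , vs⁻ = map⁻ vs⁺ , map⁻ vs⁻

  Model : ELP n → Set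
  Model P = All (⊨⁺_ ∘ ruleFm) P

  Supported : Lit n → ELP n → Set
  Supported L P = Any (λ r → head r ≡ just L × ⊨⁺ bodyFm r) P

  ⊨⁺-sup⇒Supported : ∀ L P → ⊨⁺ sup L P → Supported L P
  ⊨⁺-sup⇒Supported L P v with K L P
  ... | _ ∷ _ with anyFact L P in fact
  ...   | true = Any.map (λ (hd , body≡⊤) → hd , subst ⊨⁺_ (sym body≡⊤) id)
                   (anyFact⇒fact P fact)
  ...   | false = Any-K⁻ P (⊨⁺-⋁⁻ (K L P) v)

  Supported⇒⊨⁺-sup : ∀ L P → Supported L P → ⊨⁺ sup L P
  Supported⇒⊨⁺-sup L P s with K L P in eq
  ... | [] = ⊥-elim (¬Any[] (subst (Any ⊨⁺_) eq (Any-K⁺ P s)))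
  ... | _ ∷ _ with anyFact L P
  ...   | true = id
  ...   | false = ⊨⁺-⋁⁺ (Any-K⁺ P s)

module HereThere {n : ℕ} (H T : Lit n → Bool) (H⊆T : ∀ {l} → l ∈M H → l ∈M T)
                 (T-consistent : ConsistentLits T) where

  open Classical T

  -- Truth and falsity at the world H of the two-world Kripke frame H ≤ T; T is classical.
  infix 4 ⊩⁺_ ⊩⁻_

  ⊩⁺_ ⊩⁻_ : Fm n → Set
  ⊩⁺ atom a = pos a ∈M H
  ⊩⁺ ⊥' = ⊥
  ⊩⁺ (α ∧ β) = ⊩⁺ α × ⊩⁺ β
  ⊩⁺ (α ∨ β) = ⊩⁺ α ⊎ ⊩⁺ β
  ⊩⁺ (α ⇒ β) = (⊩⁺ α → ⊩⁺ β) × (⊨⁺ α → ⊨⁺ β)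
  ⊩⁺ (∼ α) = ⊩⁻ α
  ⊩⁻ atom a = neg a ∈M H
  ⊩⁻ ⊥' = Unit
  ⊩⁻ (α ∧ β) = ⊩⁻ α ⊎ ⊩⁻ β
  ⊩⁻ (α ∨ β) = ⊩⁻ α × ⊩⁻ β
  ⊩⁻ (α ⇒ β) = ⊩⁺ α × ⊩⁻ β
  ⊩⁻ (∼ α) = ⊩⁺ α

  ⊩⁺⇒⊨⁺ : ∀ φ → ⊩⁺ φ → ⊨⁺ φ
  ⊩⁻⇒⊨⁻ : ∀ φ → ⊩⁻ φ → ⊨⁻ φ
  ⊩⁺⇒⊨⁺ (atom a) = H⊆T
  ⊩⁺⇒⊨⁺ ⊥' = id
  ⊩⁺⇒⊨⁺ (α ∧ β) (u , v) = ⊩⁺⇒⊨⁺ α u , ⊩⁺⇒⊨⁺ β v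
  ⊩⁺⇒⊨⁺ (α ∨ β) = ⊎-map (⊩⁺⇒⊨⁺ α) (⊩⁺⇒⊨⁺ β)
  ⊩⁺⇒⊨⁺ (α ⇒ β) = proj₂
  ⊩⁺⇒⊨⁺ (∼ α) = ⊩⁻⇒⊨⁻ α
  ⊩⁻⇒⊨⁻ (atom a) = H⊆T
  ⊩⁻⇒⊨⁻ ⊥' = id
  ⊩⁻⇒⊨⁻ (α ∧ β) = ⊎-map (⊩⁻⇒⊨⁻ α) (⊩⁻⇒⊨⁻ β)
  ⊩⁻⇒⊨⁻ (α ∨ β) (u , v) = ⊩⁻⇒⊨⁻ α u , ⊩⁻⇒⊨⁻ β v
  ⊩⁻⇒⊨⁻ (α ⇒ β) (u , v) = ⊩⁺⇒⊨⁺ α u , ⊩⁻⇒⊨⁻ β v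
  ⊩⁻⇒⊨⁻ (∼ α) = ⊩⁺⇒⊨⁺ α

  ⊩⁺? : ∀ φ → Dec (⊩⁺ φ)
  ⊩⁻? : ∀ φ → Dec (⊩⁻ φ)
  ⊩⁺? (atom a) = H (pos a) ≟ᴮ true
  ⊩⁺? ⊥' = no λ ()
  ⊩⁺? (α ∧ β) = ⊩⁺? α ×-dec ⊩⁺? β
  ⊩⁺? (α ∨ β) = ⊩⁺? α ⊎-dec ⊩⁺? β
  ⊩⁺? (α ⇒ β) = (⊩⁺? α →-dec ⊩⁺? β) ×-dec (⊨⁺? α →-dec ⊨⁺? β)
  ⊩⁺? (∼ α) = ⊩⁻? α
  ⊩⁻? (atom a) = H (neg a) ≟ᴮ true
  ⊩⁻? ⊥' = yes tt
  ⊩⁻? (α ∧ β) = ⊩⁻? α ⊎-dec ⊩⁻? β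
  ⊩⁻? (α ∨ β) = ⊩⁻? α ×-dec ⊩⁻? β
  ⊩⁻? (α ⇒ β) = ⊩⁺? α ×-dec ⊩⁻? β
  ⊩⁻? (∼ α) = ⊩⁺? α

  ⊩⁺-N₂-axiom : ∀ α β → ⊩⁺ α ∨ (α ⇒ β) ∨ ¬' β
  ⊩⁺-N₂-axiom α β with ⊩⁺? α | ⊨⁺? α | ⊨⁺? β
  ... | yes u | _ | _ = inj₁ u
  ... | no ¬u | no ¬v | _ = inj₂ (inj₁ (⊥-elim ∘ ¬u , ⊥-elim ∘ ¬v))
  ... | no ¬u | yes _ | yes w = inj₂ (inj₁ (⊥-elim ∘ ¬u , const w))
  ... | no _ | yes _ | no ¬w = inj₂ (inj₂ (¬w ∘ ⊩⁺⇒⊨⁺ β , ¬w))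

  ⊩-sound : All ⊩⁺_ Γ → Γ ⊢ φ → ⊩⁺ φ
  ⊩-sound hs (hyp φ∈Γ) = All.lookup hs φ∈Γ
  ⊩-sound hs (mp d e) = proj₁ (⊩-sound hs d) (⊩-sound hs e)
  ⊩-sound _ (ax-K {α}) = (λ u → const u , const (⊩⁺⇒⊨⁺ α u)) , const
  ⊩-sound _ ax-S =
    (λ f → (λ g → (λ u → proj₁ (proj₁ f u) (proj₁ g u)) , (λ v → proj₂ f v (proj₂ g v)))
         , (λ g v → proj₂ f v (g v)))
    , (λ f g v → f v (g v))
  ⊩-sound _ ax-∧E₁ = proj₁ , proj₁
  ⊩-sound _ ax-∧E₂ = proj₂ , proj₂
  ⊩-sound _ (ax-∧I {α}) = (λ u → (u ,_) , (⊩⁺⇒⊨⁺ α u ,_)) , _,_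
  ⊩-sound _ ax-∨I₁ = inj₁ , inj₁
  ⊩-sound _ ax-∨I₂ = inj₂ , inj₂
  ⊩-sound _ ax-∨E =
    (λ f → (λ g → [ proj₁ f , proj₁ g ] , [ proj₂ f , proj₂ g ]) , (λ g → [ proj₂ f , g ]))
    , [_,_]
  ⊩-sound _ ax-⊥E = ⊥-elim , ⊥-elim
  ⊩-sound _ ax-N1 = (id , id) , (id , id)
  ⊩-sound _ ax-N2 = (id , id) , (id , id)
  ⊩-sound _ ax-N3 = (id , id) , (id , id)
  ⊩-sound _ ax-N4 = (id , id) , (id , id)
  ⊩-sound _ ax-N5 = (proj₁ , proj₁) , ((_, tt) , (_, tt))
  ⊩-sound _ (ax-N6 {a}) =
    (λ u → (λ w → T-consistent a (H⊆T w , H⊆T u)) , (λ w → T-consistent a (w , H⊆T u)))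
    , (λ u w → T-consistent a (w , u))
  ⊩-sound _ (ax-N₂ {α} {β}) = ⊩⁺-N₂-axiom α β

  ∈M⇒⊩⁺ : ∀ l → l ∈M H → ⊩⁺ litFm l
  ∈M⇒⊩⁺ (pos a) = id
  ∈M⇒⊩⁺ (neg a) = id

  ⊩⁺⇒∈M : ∀ l → ⊩⁺ litFm l → l ∈M H
  ⊩⁺⇒∈M (pos a) = id
  ⊩⁺⇒∈M (neg a) = id

  ⊩⁺-⋀⁺ : ∀ {φs} → All ⊩⁺_ φs → ⊩⁺ ⋀ φs
  ⊩⁺-⋀⁺ [] = id , id
  ⊩⁺-⋀⁺ (u ∷ []) = u
  ⊩⁺-⋀⁺ (u ∷ us@(_ ∷ _)) = u , ⊩⁺-⋀⁺ us

  ⊩⁺-¬⁺ : ∀ φ → ¬ ⊨⁺ φ → ⊩⁺ ¬' φ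
  ⊩⁺-¬⁺ φ ¬v = ¬v ∘ ⊩⁺⇒⊨⁺ φ , ¬v

  ⊩⁺-bodyFm⁺ : ∀ r → All (⊩⁺_ ∘ belemFm) (posB r) → All (¬_ ∘ ⊨⁺_ ∘ belemFm) (negB r) →
               ⊩⁺ bodyFm r
  ⊩⁺-bodyFm⁺ r us ¬vs =
    ⊩⁺-⋀⁺ (++⁺ (map⁺ us) (map⁺ (All.map (λ {b} → ⊩⁺-¬⁺ (belemFm b)) ¬vs)))

_∖_ : (Lit n → Bool) → Lit n → Lit n → Bool
(M ∖ ℓ) l with l ≟L ℓ
... | yes _ = false
... | no _ = M l

∖-⊆ : ∀ {M : Lit n → Bool} {ℓ l} → l ∈M (M ∖ ℓ) → l ∈M M
∖-⊆ {ℓ = ℓ} {l} l∈ with l ≟L ℓ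
∖-⊆ () | yes _
∖-⊆ l∈ | no _ = l∈

∖-∉ : ∀ {M : Lit n → Bool} ℓ → ¬ ℓ ∈M (M ∖ ℓ)
∖-∉ ℓ ℓ∈ with ℓ ≟L ℓ
∖-∉ ℓ () | yes _
∖-∉ ℓ ℓ∈ | no ℓ≢ℓ = ℓ≢ℓ refl

∖-∈ : ∀ {M : Lit n → Bool} {ℓ l} → l ≢ ℓ → l ∈M M → l ∈M (M ∖ ℓ)
∖-∈ {ℓ = ℓ} {l} l≢ℓ l∈ with l ≟L ℓ
... | yes l≡ℓ = ⊥-elim (l≢ℓ l≡ℓ)
... | no _ = l∈

module _ {n : ℕ} {M : Lit n → Bool} (M-consistent : ConsistentLits M) where
  open Classical M

  unsupported-transfer : ∀ {Pa Pb : ELP n} {ℓ} → TauFree Pa → ⟦ Pb ⟧ ⊢* ⟦ Pa ⟧ → Model Pb →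
                         ¬ Supported ℓ Pb → ¬ Supported ℓ Pa
  unsupported-transfer {Pa} {Pb} {ℓ} tauFree Pb⊢Pa model unsupported supported
    with find supported
  ... | r , r∈Pa , hd , v = ∖-∉ ℓ (⊩⁺⇒∈M ℓ (subst (⊩⁺_ ∘ headFm) hd (proj₁ r-here body-here)))
    where
    open HereThere (M ∖ ℓ) M (∖-⊆ {M = M}) M-consistent

    head-here : ∀ {B} h → (⊨⁺ B → ⊨⁺ headFm h) → (h ≡ just ℓ → ¬ ⊨⁺ B) → ⊨⁺ B → ⊩⁺ headFm h
    head-here nothing holds _ u = holds u
    head-here (just l) holds unsup u with l ≟L ℓ
    ... | yes refl = ⊥-elim (unsup refl u)
    ... | no l≢ℓ = ∈M⇒⊩⁺ l (∖-∈ l≢ℓ (⊨⁺⇒∈M l (holds u)))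

    Pb-here : ∀ {r} → r ∈ Pb → ⊩⁺ ruleFm r
    Pb-here {r} r∈Pb = head-here {bodyFm r} (head r) holds unfired ∘ ⊩⁺⇒⊨⁺ (bodyFm r) , holds
      where
      holds : ⊨⁺ ruleFm r
      holds = All.lookup model r∈Pb

      unfired : head r ≡ just ℓ → ¬ ⊨⁺ bodyFm r
      unfired hd u = unsupported (lose r∈Pb (hd , u))

    r-here : ⊩⁺ ruleFm r
    r-here = ⊩-sound (map⁺ (All.tabulate Pb-here)) (All.lookup Pb⊢Pa (∈-map⁺ ruleFm r∈Pa))

    belem-here : ∀ b → b ≢ lit ℓ → ⊨⁺ belemFm b → ⊩⁺ belemFm b
    belem-here (lit l) b≢ℓ u = ∈M⇒⊩⁺ l (∖-∈ (b≢ℓ ∘ cong lit) (⊨⁺⇒∈M l u))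
    belem-here top _ _ = id , id
    belem-here bot _ ()

    body-here : ⊩⁺ bodyFm r
    body-here with ⊨⁺-bodyFm⁻ r v
    ... | us , ¬vs = ⊩⁺-bodyFm⁺ r (All.tabulate λ {b} b∈ →
                        belem-here b (λ { refl → tauFree r∈Pa ℓ hd b∈ }) (All.lookup us b∈)) ¬vs

answerSet-transfer : ∀ {T T′ : List (Fm n)} {M} →
                     (T ++ reductAssumptions n M) ≡N₂ (T′ ++ reductAssumptions n M) →
                     AnswerSet T M → AnswerSet T′ M
answerSet-transfer (to , from) (M-consistent , consistent , derives) =
  M-consistent , consistent ∘ ⊢-cut to , λ l l∈M → ⊢-cut from (derives l l∈M)

module Reduct {n : ℕ} (M : Lit n → Bool) where
  open Classical M

  R : List (Fm n)
  R = reductAssumptions n M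

  private
    assumption : Bool → Lit n → Fm n
    assumption b l = if b then ¬' (¬' (litFm l)) else ¬' (litFm l)

    R⊢assumption : ∀ l → R ⊢ assumption (M l) l
    R⊢assumption l = hyp (∈-map⁺ (λ l → assumption (M l) l) (∈-allLits l))

  R⊢¬¬ : ∀ {G} → IsG G → ⊨⁺ G → R ⊢ ¬' (¬' G)
  R⊢¬ : ∀ {G} → IsG G → ¬ ⊨⁺ G → R ⊢ ¬' G
  R⊢¬¬ (g-lit l) u = subst (λ b → R ⊢ assumption b l) (⊨⁺⇒∈M l u) (R⊢assumption l)
  R⊢¬¬ g-⊤ _ = ¬¬-intro ⊢-id
  R⊢¬¬ g-⊥ ()
  R⊢¬¬ (g-∧ g h) (u , v) = ¬¬-∧ (R⊢¬¬ g u) (R⊢¬¬ h v)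
  R⊢¬¬ (g-∨ g h) (inj₁ u) = ¬¬-map ax-∨I₁ (R⊢¬¬ g u)
  R⊢¬¬ (g-∨ g h) (inj₂ v) = ¬¬-map ax-∨I₂ (R⊢¬¬ h v)
  R⊢¬¬ (g-¬ g) ¬u = ¬¬-intro (R⊢¬ g ¬u)
  R⊢¬ (g-lit l) ¬u = subst (λ b → R ⊢ assumption b l) (¬-not (¬u ∘ ∈M⇒⊨⁺ l)) (R⊢assumption l)
  R⊢¬ g-⊤ ¬u = ⊥-elim (¬u id)
  R⊢¬ g-⊥ _ = ⊢-id
  R⊢¬ (g-∧ {G} g h) ¬uv with ⊨⁺? G
  ... | yes u = ¬-∧ʳ (R⊢¬ h (λ v → ¬uv (u , v)))
  ... | no ¬u = ¬-∧ˡ (R⊢¬ g ¬u)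
  R⊢¬ (g-∨ g h) ¬uv = ¬-∨ (R⊢¬ g (¬uv ∘ inj₁)) (R⊢¬ h (¬uv ∘ inj₂))
  R⊢¬ (g-¬ {G} g) ¬¬u with ⊨⁺? G
  ... | yes u = R⊢¬¬ g u
  ... | no ¬u = ⊥-elim (¬¬u ¬u)

  consistent⇒⊨⁺ : R ⊆ Γ → ConsistentN₂ Γ → ∀ {r} → Γ ⊢ ruleFm r → ⊨⁺ ruleFm r
  consistent⇒⊨⁺ {Γ = Γ} R⊆Γ consistent {r} Γ⊢r u =
    head-holds (head r) (¬¬-map Γ⊢r (⊢-weaken R⊆Γ (R⊢¬¬ (IsG-bodyFm r) u)))
    where
    head-holds : ∀ h → Γ ⊢ ¬' (¬' (headFm h)) → ⊨⁺ headFm h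
    head-holds nothing d = consistent (¬¬⊥-elim d)
    head-holds (just l) d with ⊨⁺? (litFm l)
    ... | yes v = v
    ... | no ¬v = ⊥-elim (consistent (mp d (⊢-weaken R⊆Γ (R⊢¬ (g-lit l) ¬v))))

  consistent⇒Model : R ⊆ Γ → ConsistentN₂ Γ → ∀ {P} → Γ ⊢* ⟦ P ⟧ → Model P
  consistent⇒Model R⊆Γ consistent Γ⊢P =
    All.map (λ {r} → consistent⇒⊨⁺ R⊆Γ consistent {r}) (map⁻ Γ⊢P)

  weakened-transfer : ∀ {Pa Pb} → R ⊆ Γ → (∀ {ℓ} → ¬ Supported ℓ Pb → ¬ Supported ℓ Pa) →
                      ∀ P → Γ ⊢* weakened P Pa → Γ ⊢* weakened P Pb
  weakened-transfer R⊆Γ unsup [] [] = []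
  weakened-transfer R⊆Γ unsup (record { head = nothing } ∷ P) ds = weakened-transfer R⊆Γ unsup P ds
  weakened-transfer {Γ = Γ} {Pa} {Pb} R⊆Γ unsup (r@record { head = just L } ∷ P) (d ∷ ds) =
    rule (⊨⁺? (sup (compl L) Pb)) ∷ weakened-transfer R⊆Γ unsup P ds
    where
    rule : Dec (⊨⁺ sup (compl L) Pb) → Γ ⊢ bodyFm r ∧ ¬' (sup (compl L) Pb) ⇒ litFm L
    rule (yes v) = ∧-antecedent-absurd (⊢-weaken R⊆Γ (R⊢¬¬ (IsG-sup _ Pb) v))
    rule (no ¬v) = ∧-antecedent-discharge (⊢-weaken R⊆Γ (R⊢¬ (IsG-sup _ Pa) ¬u)) d
      where
      ¬u : ¬ ⊨⁺ sup (compl L) Pa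
      ¬u = unsup (¬v ∘ Supported⇒⊨⁺-sup _ Pb) ∘ ⊨⁺-sup⇒Supported _ Pa

  ⊕₃-transfer : ∀ P {Pa Pb} → ⟦ Pa ⟧ ⊢* ⟦ Pb ⟧ → (∀ {ℓ} → ¬ Supported ℓ Pb → ¬ Supported ℓ Pa) →
                ((P ⊕₃ Pa) ++ R) ⊢* ((P ⊕₃ Pb) ++ R)
  ⊕₃-transfer P {Pa} {Pb} Pa⊢Pb unsup =
    ++⁺ (++⁺ constraints-derived (++⁺ weakened-derived Pb-derived)) (⊆⇒⊢* (xs⊆ys++xs R _))
    where
    ⊕₃⊆Γ : P ⊕₃ Pa ⊆ (P ⊕₃ Pa) ++ R
    ⊕₃⊆Γ = xs⊆xs++ys _ R

    Pb-derived : ((P ⊕₃ Pa) ++ R) ⊢* ⟦ Pb ⟧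
    Pb-derived = ⊢*-trans (⊆⇒⊢* (⊕₃⊆Γ ∘ ⟦⟧⊆⊕₃ {P₂ = Pa} {P})) Pa⊢Pb

    weakened-derived : ((P ⊕₃ Pa) ++ R) ⊢* weakened P Pb
    weakened-derived =
      weakened-transfer (xs⊆ys++xs R _) unsup P (⊆⇒⊢* (⊕₃⊆Γ ∘ weakened⊆⊕₃ {P₁ = P}))

    constraints-derived : ((P ⊕₃ Pa) ++ R) ⊢* ⟦ constraints (P ++ Pb) ⟧
    constraints-derived = ⊢*-trans (++⁺ (⊆⇒⊢* (⊕₃⊆Γ ∘ constraints⊆⊕₃ {P₁ = P})) Pb-derived)
                                   (⊆⇒⊢* (⟦constraints-++⟧-⊆ P))

  ⊕₃-≡N₂ : ConsistentLits M → ∀ P {P₁ P₂} → TauFree P₁ → TauFree P₂ → ⟦ P₁ ⟧ ≡N₂ ⟦ P₂ ⟧ →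
           ConsistentN₂ ((P ⊕₃ P₁) ++ R) → ((P ⊕₃ P₁) ++ R) ≡N₂ ((P ⊕₃ P₂) ++ R)
  ⊕₃-≡N₂ M-consistent P {P₁} {P₂} tauFree₁ tauFree₂ (P₁⊢P₂ , P₂⊢P₁) consistent =
    ⊕₃-transfer P P₁⊢P₂ (unsupported-transfer M-consistent tauFree₁ P₂⊢P₁ model₂) ,
    ⊕₃-transfer P P₂⊢P₁ (unsupported-transfer M-consistent tauFree₂ P₁⊢P₂ model₁)
    where
    Γ⊢P₁ : ((P ⊕₃ P₁) ++ R) ⊢* ⟦ P₁ ⟧
    Γ⊢P₁ = ⊆⇒⊢* (xs⊆xs++ys _ R ∘ ⟦⟧⊆⊕₃ {P₂ = P₁} {P})

    model₁ : Model P₁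
    model₁ = consistent⇒Model (xs⊆ys++xs R _) consistent Γ⊢P₁

    model₂ : Model P₂
    model₂ = consistent⇒Model (xs⊆ys++xs R _) consistent (⊢*-trans Γ⊢P₁ P₁⊢P₂)

  ⊕₃-answerSet : ∀ P {P₁ P₂} → TauFree P₁ → TauFree P₂ → ⟦ P₁ ⟧ ≡N₂ ⟦ P₂ ⟧ →
                 AnswerSet (P ⊕₃ P₁) M → AnswerSet (P ⊕₃ P₂) M
  ⊕₃-answerSet P tauFree₁ tauFree₂ P₁≡P₂ A@(M-consistent , consistent , _) =
    answerSet-transfer (⊕₃-≡N₂ M-consistent P tauFree₁ tauFree₂ P₁≡P₂ consistent) A

theorem5p6 : (n : ℕ) →
      -- (BK-1)
      ((P : ELP n) (x : Rule n) → IsProgram (P ⊕₃ (x ∷ [])))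
      -- (BK-2)
    × ((P₁ P₂ : ELP n) → (P₁ ⊕₃ P₂) ⊢* ⟦ P₂ ⟧)
      -- (BK-3)
    × ((P₁ P₂ : ELP n) → ⟦ P₁ ++ P₂ ⟧ ⊢* (P₁ ⊕₃ P₂))
      -- (BK-5)
    × ((P₁ P₂ : ELP n) → InconsistentN₂ ⟦ P₂ ⟧ → InconsistentN₂ (P₁ ⊕₃ P₂))
      -- (BK-6) for tau-free P₁, P₂
    × ((P P₁ P₂ : ELP n) → TauFree P₁ → TauFree P₂ → ⟦ P₁ ⟧ ≡N₂ ⟦ P₂ ⟧ →
        (M : Lit n → Bool) → AnswerSet (P ⊕₃ P₁) M ⇔ AnswerSet (P ⊕₃ P₂) M)
theorem5p6 n =
    (λ P x → IsProgram-⊕₃ P (x ∷ []))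
  , ⊕₃-⊢*-⟦⟧
  , ++-⊢*-⊕₃
  , ⊕₃-inconsistent
  , λ P P₁ P₂ tauFree₁ tauFree₂ P₁≡P₂ M →
      mk⇔ (Reduct.⊕₃-answerSet M P tauFree₁ tauFree₂ P₁≡P₂)
          (Reduct.⊕₃-answerSet M P tauFree₂ tauFree₁ (swap P₁≡P₂))
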